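{- Let $d \ge 3$ be a prime, and define polynomials $r_n, s_n \in \mathbb{Z}[b]$ by $r_0 = s_0 = 1$ and, for $n \ge 0$, \[ r_{n+1} = (b+1)\,d\, r_n s_n^{d-1}, \qquad s_{n+1} = r_n^d + (d-1) s_n^d. \] For $k \ge 0$ let $D_k = \frac{d^k - 1}{d-1} = d^{k-1} + \cdots + d + 1$. Then for every $m \ge 2$, \[ N_d^-(s_m) = L\bigl((0, D_m), (d^{m-1}, d^{m-1})\bigr), \] that is, the principal $d$-Newton polygon of $s_m$ has initial point $(0, D_m)$ and consists of a single line segment, of slope $-D_{m-1}/d^{m-1}$, ending at the vertex $(d^{m-1}, d^{m-1})$. Equivalently, writing $v_i(s_m)$ for the $d$-adic valuation of the coefficient of $b^i$ in $s_m$: $v_0(s_m) = D_m$; $v_i(s_m) \ge D_m - \frac{D_{m-1} i}{d^{m-1}}$ for $0 < i < d^{m-1}$; $v_{d^{m-1}}(s_m) = d^{m-1}$; and $v_i(s_m) \ge d^{m-1}$ for $i > d^{m-1}$.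
   Context: For a prime $p$ and $f(z) = \sum_{i=0}^n a_i z^i \in \mathbb{Q}[z]$ with $a_n \ne 0$, write $v_i(f) = \mathrm{ord}_p(a_i)$ (with $\mathrm{ord}_p(0) = \infty$). The $p$-Newton polygon $N_p(f)$ is the lower convex hull of the points $(i, v_i(f))$, $0 \le i \le n$; its vertices are the points where the slope changes, together with the two endpoints. The principal $p$-Newton polygon $N_p^-(f)$ is the part of $N_p(f)$ consisting of the segments of negative slope (including slope $-\infty$). The notation $N_p^-(f) = L\bigl((i_1, v_{i_1}(f)), \dots, (i_k, v_{i_k}(f))\bigr)$ means that $i_1 = \min\{i : v_i(f) < \infty\}$ (the initial point is $(i_1, v_{i_1}(f))$), $i_1 < \cdots < i_k$, and these are exactly the vertices of $N_p^-(f)$ with finite coordinates. -}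

module Defs where

open import Data.Nat as ℕ using (ℕ; zero; suc)
open import Data.Nat.Divisibility using (_∣_)
open import Data.Integer as ℤ using (ℤ; +_; ∣_∣)
open import Data.List using (List; []; _∷_)
open import Data.Maybe using (Maybe; just; nothing)
open import Data.Product using (_×_)
open import Data.Unit using (⊤)
open import Relation.Nullary using (¬_)
open import Relation.Binary.PropositionalEquality using (_≡_)

-- Polynomials in ℤ[b] as coefficient lists, constant term first.
-- The list a₀ ∷ a₁ ∷ … ∷ aₙ ∷ [] represents a₀ + a₁ b + … + aₙ bⁿ.

Poly : Set
Poly = List ℤ

coeff : Poly → ℕ → ℤ
coeff []       _       = + 0
coeff (a ∷ f) zero    = a
coeff (a ∷ f) (suc i) = coeff f i

infixl 6 _⊕_
infixl 7 _⊛_ _·_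

_⊕_ : Poly → Poly → Poly
[]      ⊕ g       = g
(a ∷ f) ⊕ []      = a ∷ f
(a ∷ f) ⊕ (c ∷ g) = (a ℤ.+ c) ∷ (f ⊕ g)

_·_ : ℤ → Poly → Poly
c · []      = []
c · (a ∷ f) = (c ℤ.* a) ∷ (c · f)

_⊛_ : Poly → Poly → Poly
[]      ⊛ g = []
(a ∷ f) ⊛ g = (a · g) ⊕ (+ 0 ∷ (f ⊛ g))

one : Poly
one = + 1 ∷ []

infixr 8 _^ᴾ_
_^ᴾ_ : Poly → ℕ → Poly
f ^ᴾ zero  = one
f ^ᴾ suc n = f ⊛ (f ^ᴾ n)

b+1 : Poly
b+1 = + 1 ∷ + 1 ∷ []

rs : ℕ → ℕ → Poly × Poly
rs d zero    = one Data.Product., one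
rs d (suc n) =
  let r = Data.Product.proj₁ (rs d n)
      s = Data.Product.proj₂ (rs d n)
  in  (b+1 ⊛ ((+ d) · (r ⊛ (s ^ᴾ (d ℕ.∸ 1)))))
      Data.Product., ((r ^ᴾ d) ⊕ ((+ (d ℕ.∸ 1)) · (s ^ᴾ d)))

r : ℕ → ℕ → Poly
r d n = Data.Product.proj₁ (rs d n)

s : ℕ → ℕ → Poly
s d n = Data.Product.proj₂ (rs d n)

D : ℕ → ℕ → ℕ
D d zero    = 0
D d (suc k) = d ℕ.^ k ℕ.+ D d k

-- p-adic valuation with values in ℕ ∪ {∞}; ∞ is represented by nothing.

ℕ∞ : Set
ℕ∞ = Maybe ℕ

HasOrd : ℕ → ℤ → ℕ∞ → Set
HasOrd p a (just n) = (p ℕ.^ n ∣ ∣ a ∣) × ¬ (p ℕ.^ suc n ∣ ∣ a ∣)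
HasOrd p a nothing  = a ≡ + 0

_≥∞_ : ℕ∞ → ℕ → Set
just n  ≥∞ k = k ℕ.≤ n
nothing ≥∞ k = ⊤

-- the rational inequality  v ≥ A - B·i / q  (q > 0), cleared of denominators:
--   q·v + B·i ≥ A·q   (vacuous for v = ∞)
AboveLine : (A B q i : ℕ) → ℕ∞ → Set
AboveLine A B q i (just n) = A ℕ.* q ℕ.≤ q ℕ.* n ℕ.+ B ℕ.* i
AboveLine A B q i nothing  = ⊤

{-# OPTIONS --safe #-}
-- Let k = m − 1, Q = d^k, B = D_k, and give a monomial a bⁱ the weight Q·ord_d(a) + B·i; the
-- claimed segment is the line of weight Q·D_m. With e_n = r_n − s_n, induction on j ≤ k shows
-- that r_{j+1} and s_{j+1} have weight ≥ Q·D_{j+1}, that e_{j+1} equals the monomial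
-- E_j = ±d^(d^j) b^(d^j) up to terms of weight > d^j (Q + B), and that s_{j+1} − d^D_{j+1} + E_j
-- has weight > Q·D_{j+1}. The step expands r_n^d = (s_n + e_n)^d: its middle binomial terms carry
-- a factor d, so s_{n+1} ≡ d s_n^d + e_n^d and e_{n+1} ≡ −e_n^d modulo heavier terms.
-- For j = k the last claim reads s_m = d^D_m − E_k + (terms strictly above the line), which gives
-- both vertices. The bound beyond the last vertex is the content of s_m: every coefficient of
-- s_{j+1} is divisible by d^(d^j).
module Submission where

open import Defs
open import Algebra.Bundles using (CommutativeRing; CommutativeSemiring; RawRing)
import Algebra.Properties.CommutativeSemigroup as CommutativeSemigroupProperties
import Algebra.Properties.CommutativeSemiring.Binomial as Binomial
import Algebra.Properties.Semiring.Exp as SemiringExp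
import Algebra.Properties.Semiring.Mult as SemiringMult
import Algebra.Properties.Semiring.Sum as SemiringSum
import Algebra.Solver.Ring as RingSolver
open import Algebra.Solver.Ring.AlmostCommutativeRing
  using (fromCommutativeRing; _-Raw-AlmostCommutative⟶_)
open import Data.Empty using (⊥-elim)
open import Data.Fin using (Fin; toℕ; inject₁; fromℕ)
import Data.Fin.Properties as Finₚ
open import Data.Integer as ℤ using (ℤ; +_; -_; -1ℤ; 1ℤ)
import Data.Integer.Divisibility.Signed as ℤ∣
import Data.Integer.Properties as ℤₚ
open import Data.Integer.Tactic.RingSolver using () renaming (solve-∀ to ℤ-solve)
open import Data.List using ([]; _∷_)
open import Data.Maybe using (Maybe; just; nothing)
open import Data.Nat as ℕ using (ℕ; zero; suc; _+_; _*_; _^_; _∸_; _≤_; _<_; z≤n; s≤s; _!)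
open import Data.Nat.Combinatorics using (_C_; nCk≡n!/k![n-k]!; k![n∸k]!∣n!; nCn≡1)
open import Data.Nat.Divisibility as ℕ∣ using (_∣_; divides)
open import Data.Nat.DivMod using (m*[n/m]≡n)
open import Data.Nat.Primality using (Prime; euclidsLemma; prime⇒nonTrivial)
import Data.Nat.Properties as ℕₚ
open import Data.Nat.Tactic.RingSolver using () renaming (solve-∀ to ℕ-solve)
open import Data.Product using (_×_; _,_; proj₂)
open import Data.Sum using (inj₁; inj₂)
open import Data.Unit using (tt)
open import Function using (_∘_)
open import Level using (0ℓ)
open import Relation.Binary.PropositionalEquality
import Relation.Binary.Reasoning.Setoid as SetoidReasoning
open import Relation.Nullary using (¬_; yes; no)

module ℤ+ = CommutativeSemigroupProperties ℤₚ.+-commutativeSemigroup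
module ℕ+ = CommutativeSemigroupProperties ℕₚ.+-commutativeSemigroup

-- Polynomials up to trailing zero coefficients

infix 4 _≈_
record _≈_ (f g : Poly) : Set where
  constructor mk≈
  field at : ∀ i → coeff f i ≡ coeff g i
open _≈_

≈-refl : ∀ {f} → f ≈ f
≈-refl = mk≈ λ _ → refl

≈-sym : ∀ {f g} → f ≈ g → g ≈ f
≈-sym p = mk≈ λ i → sym (at p i)

≈-trans : ∀ {f g h} → f ≈ g → g ≈ h → f ≈ h
≈-trans p q = mk≈ λ i → trans (at p i) (at q i)

∷-cong : ∀ {a a′ f f′} → a ≡ a′ → f ≈ f′ → a ∷ f ≈ a′ ∷ f′
∷-cong p q = mk≈ λ { zero → p ; (suc i) → at q i }

neg : Poly → Poly
neg f = -1ℤ · f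

infixl 6 _⊖_
_⊖_ : Poly → Poly → Poly
f ⊖ g = f ⊕ neg g

cst : ℤ → Poly
cst c = c ∷ []

X : Poly
X = + 0 ∷ + 1 ∷ []

coeff-⊕ : ∀ f g i → coeff (f ⊕ g) i ≡ coeff f i ℤ.+ coeff g i
coeff-⊕ []      g       i       = sym (ℤₚ.+-identityˡ _)
coeff-⊕ (a ∷ f) []      i       = sym (ℤₚ.+-identityʳ _)
coeff-⊕ (a ∷ f) (c ∷ g) zero    = refl
coeff-⊕ (a ∷ f) (c ∷ g) (suc i) = coeff-⊕ f g i

coeff-· : ∀ c f i → coeff (c · f) i ≡ c ℤ.* coeff f i
coeff-· c []      i       = sym (ℤₚ.*-zeroʳ c)
coeff-· c (a ∷ f) zero    = refl
coeff-· c (a ∷ f) (suc i) = coeff-· c f i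

coeff-neg : ∀ f i → coeff (neg f) i ≡ - coeff f i
coeff-neg f i = trans (coeff-· -1ℤ f i) (ℤₚ.-1*i≡-i _)

cst⊛≈· : ∀ c f → cst c ⊛ f ≈ c · f
cst⊛≈· c f = mk≈ λ i → trans (coeff-⊕ (c · f) _ i) (trans (cong (λ z → coeff (c · f) i ℤ.+ z) (zero-tail i))
                                                           (ℤₚ.+-identityʳ _))
  where zero-tail : ∀ i → coeff (+ 0 ∷ []) i ≡ + 0
        zero-tail zero    = refl
        zero-tail (suc i) = refl

conv : (ℕ → ℤ) → (ℕ → ℤ) → ℕ → ℤ
conv F G zero    = F 0 ℤ.* G 0
conv F G (suc k) = F 0 ℤ.* G (suc k) ℤ.+ conv (λ i → F (suc i)) G k

conv-cong : ∀ {F F′ G G′} → (∀ i → F i ≡ F′ i) → (∀ i → G i ≡ G′ i) →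
            ∀ k → conv F G k ≡ conv F′ G′ k
conv-cong p q zero    = cong₂ ℤ._*_ (p 0) (q 0)
conv-cong p q (suc k) = cong₂ ℤ._+_ (cong₂ ℤ._*_ (p 0) (q (suc k))) (conv-cong (λ i → p (suc i)) q k)

conv-zeroˡ : ∀ G k → conv (λ _ → + 0) G k ≡ + 0
conv-zeroˡ G zero    = refl
conv-zeroˡ G (suc k) = trans (ℤₚ.+-identityˡ _) (conv-zeroˡ G k)

conv-zeroʳ : ∀ F k → conv F (λ _ → + 0) k ≡ + 0
conv-zeroʳ F zero    = ℤₚ.*-zeroʳ (F 0)
conv-zeroʳ F (suc k) = cong₂ ℤ._+_ (ℤₚ.*-zeroʳ (F 0)) (conv-zeroʳ (λ i → F (suc i)) k)

conv-distribʳ : ∀ F G H k → conv (λ i → F i ℤ.+ G i) H k ≡ conv F H k ℤ.+ conv G H k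
conv-distribʳ F G H zero    = ℤₚ.*-distribʳ-+ (H 0) (F 0) (G 0)
conv-distribʳ F G H (suc k) =
  trans (cong₂ ℤ._+_ (ℤₚ.*-distribʳ-+ (H (suc k)) (F 0) (G 0))
                     (conv-distribʳ (λ i → F (suc i)) (λ i → G (suc i)) H k))
        (ℤ+.interchange (F 0 ℤ.* H (suc k)) (G 0 ℤ.* H (suc k)) _ _)

conv-distribˡ : ∀ F G H k → conv F (λ i → G i ℤ.+ H i) k ≡ conv F G k ℤ.+ conv F H k
conv-distribˡ F G H zero    = ℤₚ.*-distribˡ-+ (F 0) (G 0) (H 0)
conv-distribˡ F G H (suc k) =
  trans (cong₂ ℤ._+_ (ℤₚ.*-distribˡ-+ (F 0) (G (suc k)) (H (suc k)))
                     (conv-distribˡ (λ i → F (suc i)) G H k))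
        (ℤ+.interchange (F 0 ℤ.* G (suc k)) (F 0 ℤ.* H (suc k)) _ _)

conv-scaleˡ : ∀ c F G k → conv (λ i → c ℤ.* F i) G k ≡ c ℤ.* conv F G k
conv-scaleˡ c F G zero    = ℤₚ.*-assoc c (F 0) (G 0)
conv-scaleˡ c F G (suc k) =
  trans (cong₂ ℤ._+_ (ℤₚ.*-assoc c (F 0) (G (suc k))) (conv-scaleˡ c (λ i → F (suc i)) G k))
        (sym (ℤₚ.*-distribˡ-+ c _ _))

shift : (ℕ → ℤ) → ℕ → ℤ
shift H zero    = + 0
shift H (suc k) = H k

prepend : ℤ → (ℕ → ℤ) → ℕ → ℤ
prepend a G zero    = a
prepend a G (suc i) = G i

conv-unfold : ∀ F G k → conv F G k ≡ F 0 ℤ.* G k ℤ.+ shift (conv (λ i → F (suc i)) G) k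
conv-unfold F G zero    = sym (ℤₚ.+-identityʳ _)
conv-unfold F G (suc k) = refl

conv-prependʳ : ∀ F a G k → conv F (prepend a G) k ≡ a ℤ.* F k ℤ.+ shift (conv F G) k
conv-prependʳ F a G zero    = trans (ℤₚ.*-comm (F 0) a) (sym (ℤₚ.+-identityʳ _))
conv-prependʳ F a G (suc k) = begin
  F 0 ℤ.* G k ℤ.+ conv F′ (prepend a G) k
    ≡⟨ cong (λ z → F 0 ℤ.* G k ℤ.+ z) (conv-prependʳ F′ a G k) ⟩
  F 0 ℤ.* G k ℤ.+ (a ℤ.* F (suc k) ℤ.+ shift (conv F′ G) k)
    ≡⟨ ℤ+.x∙yz≈y∙xz (F 0 ℤ.* G k) (a ℤ.* F (suc k)) _ ⟩
  a ℤ.* F (suc k) ℤ.+ (F 0 ℤ.* G k ℤ.+ shift (conv F′ G) k)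
    ≡⟨ cong (λ z → a ℤ.* F (suc k) ℤ.+ z) (conv-unfold F G k) ⟨
  a ℤ.* F (suc k) ℤ.+ conv F G k ∎
  where open ≡-Reasoning
        F′ = λ i → F (suc i)

coeff-⊛ : ∀ f g k → coeff (f ⊛ g) k ≡ conv (coeff f) (coeff g) k
coeff-⊛ []      g k       = sym (conv-zeroˡ (coeff g) k)
coeff-⊛ (a ∷ f) g zero    =
  trans (coeff-⊕ (a · g) _ 0) (trans (ℤₚ.+-identityʳ _) (coeff-· a g 0))
coeff-⊛ (a ∷ f) g (suc k) =
  trans (coeff-⊕ (a · g) _ (suc k)) (cong₂ ℤ._+_ (coeff-· a g (suc k)) (coeff-⊛ f g k))

coeff-prepend : ∀ a f i → coeff (a ∷ f) i ≡ prepend a (coeff f) i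
coeff-prepend a f zero    = refl
coeff-prepend a f (suc i) = refl

⊕-cong : ∀ {f f′ g g′} → f ≈ f′ → g ≈ g′ → f ⊕ g ≈ f′ ⊕ g′
⊕-cong {f} {f′} {g} {g′} p q = mk≈ λ k →
  trans (coeff-⊕ f g k) (trans (cong₂ ℤ._+_ (at p k) (at q k)) (sym (coeff-⊕ f′ g′ k)))

·-cong : ∀ c {f f′} → f ≈ f′ → c · f ≈ c · f′
·-cong c {f} {f′} p = mk≈ λ k →
  trans (coeff-· c f k) (trans (cong (c ℤ.*_) (at p k)) (sym (coeff-· c f′ k)))

⊛-cong : ∀ {f f′ g g′} → f ≈ f′ → g ≈ g′ → f ⊛ g ≈ f′ ⊛ g′
⊛-cong {f} {f′} {g} {g′} p q = mk≈ λ k →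
  trans (coeff-⊛ f g k) (trans (conv-cong (at p) (at q) k) (sym (coeff-⊛ f′ g′ k)))

⊕-comm : ∀ f g → f ⊕ g ≈ g ⊕ f
⊕-comm f g = mk≈ λ k →
  trans (coeff-⊕ f g k) (trans (ℤₚ.+-comm (coeff f k) _) (sym (coeff-⊕ g f k)))

⊕-assoc : ∀ f g h → (f ⊕ g) ⊕ h ≈ f ⊕ (g ⊕ h)
⊕-assoc f g h = mk≈ λ k → begin
  coeff ((f ⊕ g) ⊕ h) k                      ≡⟨ coeff-⊕ (f ⊕ g) h k ⟩
  coeff (f ⊕ g) k ℤ.+ coeff h k              ≡⟨ cong (λ z → z ℤ.+ coeff h k) (coeff-⊕ f g k) ⟩
  coeff f k ℤ.+ coeff g k ℤ.+ coeff h k      ≡⟨ ℤₚ.+-assoc (coeff f k) _ _ ⟩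
  coeff f k ℤ.+ (coeff g k ℤ.+ coeff h k)    ≡⟨ cong (λ z → coeff f k ℤ.+ z) (coeff-⊕ g h k) ⟨
  coeff f k ℤ.+ coeff (g ⊕ h) k              ≡⟨ coeff-⊕ f (g ⊕ h) k ⟨
  coeff (f ⊕ (g ⊕ h)) k                      ∎
  where open ≡-Reasoning

⊕-identityˡ : ∀ f → [] ⊕ f ≈ f
⊕-identityˡ f = ≈-refl

⊕-identityʳ : ∀ f → f ⊕ [] ≈ f
⊕-identityʳ f = mk≈ λ k → trans (coeff-⊕ f [] k) (ℤₚ.+-identityʳ _)

⊕-inverseʳ : ∀ f → f ⊖ f ≈ []
⊕-inverseʳ f = mk≈ λ k →
  trans (coeff-⊕ f (neg f) k) (trans (cong (λ z → coeff f k ℤ.+ z) (coeff-neg f k)) (ℤₚ.+-inverseʳ (coeff f k)))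

⊛-distribʳ : ∀ h f g → (f ⊕ g) ⊛ h ≈ (f ⊛ h) ⊕ (g ⊛ h)
⊛-distribʳ h f g = mk≈ λ k →
  trans (coeff-⊛ (f ⊕ g) h k) (trans (conv-cong (coeff-⊕ f g) (λ _ → refl) k)
  (trans (conv-distribʳ (coeff f) (coeff g) (coeff h) k)
  (sym (trans (coeff-⊕ (f ⊛ h) _ k) (cong₂ ℤ._+_ (coeff-⊛ f h k) (coeff-⊛ g h k))))))

⊛-distribˡ : ∀ h f g → h ⊛ (f ⊕ g) ≈ (h ⊛ f) ⊕ (h ⊛ g)
⊛-distribˡ h f g = mk≈ λ k →
  trans (coeff-⊛ h (f ⊕ g) k) (trans (conv-cong (λ _ → refl) (coeff-⊕ f g) k)
  (trans (conv-distribˡ (coeff h) (coeff f) (coeff g) k)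
  (sym (trans (coeff-⊕ (h ⊛ f) _ k) (cong₂ ℤ._+_ (coeff-⊛ h f k) (coeff-⊛ h g k))))))

·-⊛-assoc : ∀ c f g → (c · f) ⊛ g ≈ c · (f ⊛ g)
·-⊛-assoc c f g = mk≈ λ k →
  trans (coeff-⊛ (c · f) g k) (trans (conv-cong (coeff-· c f) (λ _ → refl) k)
  (trans (conv-scaleˡ c (coeff f) (coeff g) k)
  (sym (trans (coeff-· c (f ⊛ g) k) (cong (c ℤ.*_) (coeff-⊛ f g k))))))

⊛-zeroʳ : ∀ f → f ⊛ [] ≈ []
⊛-zeroʳ f = mk≈ λ k →
  trans (coeff-⊛ f [] k) (trans (conv-cong (λ _ → refl) (λ _ → refl) k) (conv-zeroʳ (coeff f) k))

⊛-prependʳ : ∀ g a f → g ⊛ (a ∷ f) ≈ (a · g) ⊕ (+ 0 ∷ (g ⊛ f))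
⊛-prependʳ g a f = mk≈ λ k → begin
  coeff (g ⊛ (a ∷ f)) k
    ≡⟨ coeff-⊛ g (a ∷ f) k ⟩
  conv (coeff g) (coeff (a ∷ f)) k
    ≡⟨ conv-cong (λ _ → refl) (coeff-prepend a f) k ⟩
  conv (coeff g) (prepend a (coeff f)) k
    ≡⟨ conv-prependʳ (coeff g) a (coeff f) k ⟩
  a ℤ.* coeff g k ℤ.+ shift (conv (coeff g) (coeff f)) k
    ≡⟨ cong₂ ℤ._+_ (coeff-· a g k) (shifted k) ⟨
  coeff (a · g) k ℤ.+ coeff (+ 0 ∷ (g ⊛ f)) k
    ≡⟨ coeff-⊕ (a · g) _ k ⟨
  coeff ((a · g) ⊕ (+ 0 ∷ (g ⊛ f))) k ∎
  where open ≡-Reasoning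
        shifted : ∀ k → coeff (+ 0 ∷ (g ⊛ f)) k ≡ shift (conv (coeff g) (coeff f)) k
        shifted zero    = refl
        shifted (suc k) = coeff-⊛ g f k

⊛-comm : ∀ f g → f ⊛ g ≈ g ⊛ f
⊛-comm []      g = ≈-sym (⊛-zeroʳ g)
⊛-comm (a ∷ f) g = ≈-trans (⊕-cong ≈-refl (∷-cong refl (⊛-comm f g))) (≈-sym (⊛-prependʳ g a f))

0·-zero : ∀ f → + 0 · f ≈ []
0·-zero f = mk≈ λ k → coeff-· (+ 0) f k

⊛-assoc : ∀ f g h → (f ⊛ g) ⊛ h ≈ f ⊛ (g ⊛ h)
⊛-assoc []      g h = ≈-refl
⊛-assoc (a ∷ f) g h =
  ≈-trans (⊛-distribʳ h (a · g) _)
          (⊕-cong (·-⊛-assoc a g h) (≈-trans (⊕-cong (0·-zero h) ≈-refl) (∷-cong refl (⊛-assoc f g h))))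

⊛-identityˡ : ∀ f → one ⊛ f ≈ f
⊛-identityˡ f = ≈-trans (cst⊛≈· 1ℤ f) (mk≈ λ k → trans (coeff-· 1ℤ f k) (ℤₚ.*-identityˡ _))

⊛-identityʳ : ∀ f → f ⊛ one ≈ f
⊛-identityʳ f = ≈-trans (⊛-comm f one) (⊛-identityˡ f)

Poly-commutativeRing : CommutativeRing 0ℓ 0ℓ
Poly-commutativeRing = record
  { Carrier = Poly ; _≈_ = _≈_ ; _+_ = _⊕_ ; _*_ = _⊛_ ; -_ = neg ; 0# = [] ; 1# = one
  ; isCommutativeRing = record
    { isRing = record
      { +-isAbelianGroup = record
        { isGroup = record
          { isMonoid = record
            { isSemigroup = record
              { isMagma = record
                { isEquivalence = record { refl = ≈-refl ; sym = ≈-sym ; trans = ≈-trans }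
                ; ∙-cong = ⊕-cong }
              ; assoc = ⊕-assoc }
            ; identity = ⊕-identityˡ , ⊕-identityʳ }
          ; inverse = (λ f → ≈-trans (⊕-comm (neg f) f) (⊕-inverseʳ f)) , ⊕-inverseʳ
          ; ⁻¹-cong = ·-cong -1ℤ }
        ; comm = ⊕-comm }
      ; *-cong = ⊛-cong
      ; *-assoc = ⊛-assoc
      ; *-identity = ⊛-identityˡ , ⊛-identityʳ
      ; distrib = ⊛-distribˡ , ⊛-distribʳ }
    ; *-comm = ⊛-comm } }

ℤ-rawRing : RawRing 0ℓ 0ℓ
ℤ-rawRing = record
  { Carrier = ℤ ; _≈_ = _≡_ ; _+_ = ℤ._+_ ; _*_ = ℤ._*_ ; -_ = -_ ; 0# = + 0 ; 1# = + 1 }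

cst-homomorphism : ℤ-rawRing -Raw-AlmostCommutative⟶ fromCommutativeRing Poly-commutativeRing
cst-homomorphism = record
  { ⟦_⟧    = cst
  ; +-homo = λ a b → ≈-refl
  ; *-homo = λ a b → mk≈ λ { zero → sym (ℤₚ.+-identityʳ _) ; (suc zero) → refl ; (suc (suc i)) → refl }
  ; -‿homo = λ a → mk≈ λ { zero → sym (ℤₚ.-1*i≡-i a) ; (suc i) → refl }
  ; 0-homo = mk≈ λ { zero → refl ; (suc i) → refl }
  ; 1-homo = ≈-refl }

cst-≟ : ∀ a b → Maybe (cst a ≈ cst b)
cst-≟ a b with a ℤ.≟ b
... | yes refl = just ≈-refl
... | no _     = nothing

module ≈-Reasoning = SetoidReasoning (CommutativeRing.setoid Poly-commutativeRing)

module PolySolver = RingSolver ℤ-rawRing (fromCommutativeRing Poly-commutativeRing) cst-homomorphism cst-≟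
open PolySolver using (solve; _:=_; _:+_; _:*_; _:-_; con)

monomial : ℤ → ℕ → Poly
monomial c zero    = c ∷ []
monomial c (suc q) = + 0 ∷ monomial c q

coeff-monomial-same : ∀ c q → coeff (monomial c q) q ≡ c
coeff-monomial-same c zero    = refl
coeff-monomial-same c (suc q) = coeff-monomial-same c q

coeff-monomial-other : ∀ c {q i} → i ≢ q → coeff (monomial c q) i ≡ + 0
coeff-monomial-other c {zero}  {zero}  i≢q = ⊥-elim (i≢q refl)
coeff-monomial-other c {zero}  {suc i} i≢q = refl
coeff-monomial-other c {suc q} {zero}  i≢q = refl
coeff-monomial-other c {suc q} {suc i} i≢q = coeff-monomial-other c (i≢q ∘ cong suc)

monomial-cong : ∀ {a a′ q q′} → a ≡ a′ → q ≡ q′ → monomial a q ≈ monomial a′ q′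
monomial-cong refl refl = ≈-refl

·-monomial : ∀ a b q → a · monomial b q ≈ monomial (a ℤ.* b) q
·-monomial a b zero    = ≈-refl
·-monomial a b (suc q) = ∷-cong (ℤₚ.*-zeroʳ a) (·-monomial a b q)

monomial-⊛ : ∀ a b p q → monomial a p ⊛ monomial b q ≈ monomial (a ℤ.* b) (p + q)
monomial-⊛ a b zero    q = ≈-trans (cst⊛≈· a (monomial b q)) (·-monomial a b q)
monomial-⊛ a b (suc p) q = ≈-trans (⊕-cong (0·-zero (monomial b q)) ≈-refl) (∷-cong refl (monomial-⊛ a b p q))

monomial-^ : ∀ c q n → monomial c q ^ᴾ n ≈ monomial (c ℤ.^ n) (n * q)
monomial-^ c q zero    = ≈-refl
monomial-^ c q (suc n) =
  ≈-trans (⊛-cong (≈-refl {monomial c q}) (monomial-^ c q n)) (monomial-⊛ c (c ℤ.^ n) q (n * q))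

^ᴾ-one : ∀ n → one ^ᴾ n ≈ one
^ᴾ-one zero    = ≈-refl
^ᴾ-one (suc n) = ≈-trans (⊛-cong (≈-refl {one}) (^ᴾ-one n)) (⊛-identityˡ one)

^ᴾ-cong : ∀ {f g} n → f ≈ g → f ^ᴾ n ≈ g ^ᴾ n
^ᴾ-cong zero    f≈g = ≈-refl
^ᴾ-cong (suc n) f≈g = ⊛-cong f≈g (^ᴾ-cong n f≈g)

-- The binomial theorem modulo a prime

Poly-commutativeSemiring : CommutativeSemiring 0ℓ 0ℓ
Poly-commutativeSemiring = CommutativeRing.commutativeSemiring Poly-commutativeRing

open SemiringExp (CommutativeSemiring.semiring Poly-commutativeSemiring) using () renaming (_^_ to _^ˢ_)
open SemiringMult (CommutativeSemiring.semiring Poly-commutativeSemiring) using () renaming (_×_ to _×ˢ_)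
open SemiringSum (CommutativeSemiring.semiring Poly-commutativeSemiring) using (sum; sum-init-last)
module PolyBinomial = Binomial Poly-commutativeSemiring

^ˢ≈^ᴾ : ∀ f n → f ^ˢ n ≈ f ^ᴾ n
^ˢ≈^ᴾ f zero    = ≈-refl
^ˢ≈^ᴾ f (suc n) = ⊛-cong (≈-refl {f}) (^ˢ≈^ᴾ f n)

×ˢ≈· : ∀ m f → m ×ˢ f ≈ (+ m) · f
×ˢ≈· zero    f = ≈-sym (0·-zero f)
×ˢ≈· (suc m) f = mk≈ λ i → begin
  coeff (f ⊕ m ×ˢ f) i
    ≡⟨ coeff-⊕ f (m ×ˢ f) i ⟩
  coeff f i ℤ.+ coeff (m ×ˢ f) i
    ≡⟨ cong (λ z → coeff f i ℤ.+ z) (trans (at (×ˢ≈· m f) i) (coeff-· (+ m) f i)) ⟩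
  coeff f i ℤ.+ + m ℤ.* coeff f i
    ≡⟨ cong (λ z → z ℤ.+ + m ℤ.* coeff f i) (ℤₚ.*-identityˡ (coeff f i)) ⟨
  1ℤ ℤ.* coeff f i ℤ.+ + m ℤ.* coeff f i
    ≡⟨ ℤₚ.*-distribʳ-+ (coeff f i) 1ℤ (+ m) ⟨
  + suc m ℤ.* coeff f i
    ≡⟨ coeff-· (+ suc m) f i ⟨
  coeff (+ suc m · f) i ∎
  where open ≡-Reasoning

⊕-·-suc : ∀ m f → f ⊕ (+ m) · f ≈ (+ suc m) · f
⊕-·-suc m f = ≈-trans (⊕-cong (≈-refl {f}) (≈-sym (×ˢ≈· m f))) (×ˢ≈· (suc m) f)

-- the terms C(p+1, k) eᵏ s^(p+1-k) with 0 < k < p + 1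
middleTerms : ℕ → Poly → Poly → Poly
middleTerms p e s = sum (λ (j : Fin p) → PolyBinomial.binomialTerm e s (suc p) (Fin.suc (inject₁ j)))

binomial-middleTerms : ∀ p e s → (e ⊕ s) ^ᴾ suc p ≈ (s ^ᴾ suc p ⊕ e ^ᴾ suc p) ⊕ middleTerms p e s
binomial-middleTerms p e s = begin
  (e ⊕ s) ^ᴾ d
    ≈⟨ ^ˢ≈^ᴾ (e ⊕ s) d ⟨
  (e ⊕ s) ^ˢ d
    ≈⟨ PolyBinomial.theorem d e s ⟩
  term Fin.zero ⊕ sum (λ k → term (Fin.suc k))
    ≈⟨ ⊕-cong first (sum-init-last (λ k → term (Fin.suc k))) ⟩
  s ^ᴾ d ⊕ (middleTerms p e s ⊕ term (Fin.suc (fromℕ p)))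
    ≈⟨ ⊕-cong (≈-refl {s ^ᴾ d}) (⊕-cong (≈-refl {middleTerms p e s}) (last _ (cong suc (Finₚ.toℕ-fromℕ p)))) ⟩
  s ^ᴾ d ⊕ (middleTerms p e s ⊕ e ^ᴾ d)
    ≈⟨ rearrange (s ^ᴾ d) (e ^ᴾ d) (middleTerms p e s) ⟩
  (s ^ᴾ d ⊕ e ^ᴾ d) ⊕ middleTerms p e s ∎
  where
  open ≈-Reasoning
  d = suc p
  term = PolyBinomial.binomialTerm e s d
  first : term Fin.zero ≈ s ^ᴾ d
  first = ≈-trans (⊕-identityʳ _) (≈-trans (⊛-identityˡ _) (^ˢ≈^ᴾ s d))
  last : ∀ k → toℕ k ≡ d → term k ≈ e ^ᴾ d
  last k k≡d rewrite k≡d | nCn≡1 d | ℕₚ.n∸n≡0 d =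
    ≈-trans (⊕-identityʳ _) (≈-trans (⊛-identityʳ _) (^ˢ≈^ᴾ e d))
  rearrange : ∀ a b c → a ⊕ (c ⊕ b) ≈ (a ⊕ b) ⊕ c
  rearrange = solve 3 (λ a b c → a :+ (c :+ b) := (a :+ b) :+ c) ≈-refl

prime⇒>1 : ∀ {p} → Prime p → 1 < p
prime⇒>1 {p} pr = ℕ.nonTrivial⇒n>1 p {{prime⇒nonTrivial pr}}

prime∤! : ∀ {p} → Prime p → ∀ {m} → m < p → ¬ (p ∣ m !)
prime∤! pr {zero}  _   p∣1  = ℕₚ.<⇒≱ (prime⇒>1 pr) (ℕ∣.∣⇒≤ p∣1)
prime∤! pr {suc m} m<p p∣m! with euclidsLemma (suc m) (m !) pr p∣m!
... | inj₁ p∣1+m = ℕₚ.<⇒≱ m<p (ℕ∣.∣⇒≤ p∣1+m)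
... | inj₂ p∣m!′ = prime∤! pr (ℕₚ.<-trans (ℕₚ.n<1+n m) m<p) p∣m!′

-- p divides p! = k! (p − k)! C(p, k) but neither factorial
prime∣C : ∀ {p k} → Prime p → 0 < k → k < p → p ∣ p C k
prime∣C {suc p′} {k} pr 0<k k<p with euclidsLemma (k ! * (suc p′ ∸ k) !) (suc p′ C k) pr p∣product
  where
  product≡ : k ! * (suc p′ ∸ k) ! * (suc p′ C k) ≡ suc p′ !
  product≡ = trans (cong (k ! * (suc p′ ∸ k) ! *_) (nCk≡n!/k![n-k]! (ℕₚ.<⇒≤ k<p)))
                   (m*[n/m]≡n {{k ℕₚ.!* (suc p′ ∸ k) !≢0}} (k![n∸k]!∣n! (ℕₚ.<⇒≤ k<p)))
  p∣product : suc p′ ∣ k ! * (suc p′ ∸ k) ! * (suc p′ C k)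
  p∣product = subst (suc p′ ∣_) (sym product≡) (ℕ∣.m∣m*n (p′ !))
... | inj₂ p∣C = p∣C
... | inj₁ p∣factorials with euclidsLemma (k !) ((suc p′ ∸ k) !) pr p∣factorials
...   | inj₁ p∣k!   = ⊥-elim (prime∤! pr k<p p∣k!)
...   | inj₂ p∣p-k! = ⊥-elim (prime∤! pr (ℕₚ.∸-monoʳ-< 0<k (ℕₚ.<⇒≤ k<p)) p∣p-k!)

^-monoʳ-∣ : ∀ d {a b} → a ≤ b → d ^ a ∣ d ^ b
^-monoʳ-∣ d {a} {b} a≤b = divides (d ^ (b ∸ a)) (begin
  d ^ b                 ≡⟨ cong (d ^_) (ℕₚ.m+[n∸m]≡n a≤b) ⟨
  d ^ (a + (b ∸ a))     ≡⟨ ℕₚ.^-distribˡ-+-* d a (b ∸ a) ⟩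
  d ^ a * d ^ (b ∸ a)   ≡⟨ ℕₚ.*-comm (d ^ a) _ ⟩
  d ^ (b ∸ a) * d ^ a   ∎)
  where open ≡-Reasoning

∣-abs-+ : ∀ {k x y} → k ∣ ℤ.∣ x ∣ → k ∣ ℤ.∣ y ∣ → k ∣ ℤ.∣ x ℤ.+ y ∣
∣-abs-+ {k} {x} {y} p q =
  ℤ∣.∣⇒∣ᵤ {+ k} {x ℤ.+ y} (ℤ∣.∣m∣n⇒∣m+n {+ k} {x} {y} (ℤ∣.∣ᵤ⇒∣ {+ k} {x} p) (ℤ∣.∣ᵤ⇒∣ {+ k} {y} q))

pow∣⇒≤ord : ∀ {d x e n} → d ^ e ∣ ℤ.∣ x ∣ → ¬ (d ^ suc n ∣ ℤ.∣ x ∣) → e ≤ n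
pow∣⇒≤ord {d} {e = e} {n} d^e∣x d^n+1∤x with e ℕ.≤? n
... | yes e≤n = e≤n
... | no  e≰n = ⊥-elim (d^n+1∤x (ℕ∣.∣-trans (^-monoʳ-∣ d (ℕₚ.≰⇒> e≰n)) d^e∣x))

hasOrd-+ : ∀ {d} a c {y} → 1 < d → ℤ.∣ c ∣ ≡ d ^ a → d ^ suc a ∣ ℤ.∣ y ∣ → HasOrd d (c ℤ.+ y) (just a)
hasOrd-+ {d} a c {y} 1<d ∣c∣≡d^a d^a+1∣y = d^a∣c+y , d^a+1∤c+y
  where
  d^a∣c+y : d ^ a ∣ ℤ.∣ c ℤ.+ y ∣
  d^a∣c+y = ∣-abs-+ {x = c} {y} (ℕ∣.∣-reflexive (sym ∣c∣≡d^a)) (ℕ∣.∣-trans (^-monoʳ-∣ d (ℕₚ.n≤1+n a)) d^a+1∣y)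
  d^a+1∤c+y : ¬ (d ^ suc a ∣ ℤ.∣ c ℤ.+ y ∣)
  d^a+1∤c+y d^a+1∣c+y = ℕₚ.<⇒≱ d^a<d^a+1 (ℕ∣.∣⇒≤ {{ℕₚ.m^n≢0 d a {{d≢0}}}} d^a+1∣d^a)
    where
    d≢0 = ℕ.>-nonZero (ℕₚ.<-trans (s≤s z≤n) 1<d)
    c≡c+y-y : ∀ c y → c ≡ c ℤ.+ y ℤ.+ - y
    c≡c+y-y = ℤ-solve
    d^a+1∣d^a : d ^ suc a ∣ d ^ a
    d^a+1∣d^a = subst (d ^ suc a ∣_) (trans (cong ℤ.∣_∣ (sym (c≡c+y-y c y))) ∣c∣≡d^a)
      (∣-abs-+ {x = c ℤ.+ y} { - y} d^a+1∣c+y (subst (d ^ suc a ∣_) (sym (ℤₚ.∣-i∣≡∣i∣ y)) d^a+1∣y))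
    d^a<d^a+1 : d ^ a < d ^ suc a
    d^a<d^a+1 = subst (d ^ a <_) (ℕₚ.*-comm (d ^ a) d) (ℕₚ.m<m*n (d ^ a) d {{ℕₚ.m^n≢0 d a {{d≢0}}}} 1<d)

-- Newton-polygon weights

-- A monomial a bⁱ with dᵉ ∣ a has weight Q e + B i; so Heavyᴾ N f says that every point
-- (i, ord_d aᵢ) of f lies on or above the line Q v + B i = N.
module Weighted (d Q B : ℕ) (1≤Q : 1 ≤ Q) where

  record Heavy (N i : ℕ) (a : ℤ) : Set where
    constructor heavy
    field
      exponent : ℕ
      pow∣     : d ^ exponent ∣ ℤ.∣ a ∣
      weight≥  : N ≤ Q * exponent + B * i
  open Heavy public

  heavy-zero : ∀ {N i} → Heavy N i (+ 0)
  heavy-zero {N} {i} = heavy N ((d ^ N) ℕ∣.∣0) (begin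
    N              ≤⟨ ℕₚ.m≤n*m N Q {{ℕ.>-nonZero 1≤Q}} ⟩
    Q * N          ≤⟨ ℕₚ.m≤m+n (Q * N) (B * i) ⟩
    Q * N + B * i  ∎)
    where open ℕₚ.≤-Reasoning

  heavy-weaken : ∀ {M N i a} → M ≤ N → Heavy N i a → Heavy M i a
  heavy-weaken M≤N (heavy e p w) = heavy e p (ℕₚ.≤-trans M≤N w)

  heavy-+ : ∀ {N i a b} → Heavy N i a → Heavy N i b → Heavy N i (a ℤ.+ b)
  heavy-+ {a = a} {b} (heavy e₁ p₁ w₁) (heavy e₂ p₂ w₂) with e₁ ℕ.≤? e₂
  ... | yes e₁≤e₂ = heavy e₁ (∣-abs-+ {x = a} {b} p₁ (ℕ∣.∣-trans (^-monoʳ-∣ d e₁≤e₂) p₂)) w₁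
  ... | no  e₁≰e₂ = heavy e₂ (∣-abs-+ {x = a} {b} (ℕ∣.∣-trans (^-monoʳ-∣ d (ℕₚ.≰⇒≥ e₁≰e₂)) p₁) p₂) w₂

  heavy-neg : ∀ {N i a} → Heavy N i a → Heavy N i (- a)
  heavy-neg {a = a} (heavy e p w) = heavy e (subst (d ^ e ∣_) (sym (ℤₚ.∣-i∣≡∣i∣ a)) p) w

  heavy-* : ∀ {N M i j a b} → Heavy N i a → Heavy M j b → Heavy (N + M) (i + j) (a ℤ.* b)
  heavy-* {N} {M} {i} {j} {a} {b} (heavy e₁ p₁ w₁) (heavy e₂ p₂ w₂) = heavy (e₁ + e₂)
    (subst₂ _∣_ (sym (ℕₚ.^-distribˡ-+-* d e₁ e₂)) (sym (ℤₚ.abs-* a b)) (ℕ∣.*-pres-∣ p₁ p₂))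
    (ℕₚ.≤-trans (ℕₚ.+-mono-≤ w₁ w₂) (ℕₚ.≤-reflexive (regroup Q B e₁ e₂ i j)))
    where regroup : ∀ Q B e₁ e₂ i j →
                    (Q * e₁ + B * i) + (Q * e₂ + B * j) ≡ Q * (e₁ + e₂) + B * (i + j)
          regroup = ℕ-solve

  record Heavyᴾ (N : ℕ) (f : Poly) : Set where
    constructor heavyᴾ
    field coeff-heavy : ∀ i → Heavy N i (coeff f i)
  open Heavyᴾ public

  heavyᴾ-≈ : ∀ {N f g} → f ≈ g → Heavyᴾ N f → Heavyᴾ N g
  heavyᴾ-≈ f≈g hf = heavyᴾ λ i → subst (Heavy _ i) (at f≈g i) (coeff-heavy hf i)

  heavyᴾ-weaken : ∀ {M N f} → M ≤ N → Heavyᴾ N f → Heavyᴾ M f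
  heavyᴾ-weaken M≤N hf = heavyᴾ λ i → heavy-weaken M≤N (coeff-heavy hf i)

  heavyᴾ-[] : ∀ {N} → Heavyᴾ N []
  heavyᴾ-[] = heavyᴾ λ _ → heavy-zero

  heavyᴾ-⊕ : ∀ {N f g} → Heavyᴾ N f → Heavyᴾ N g → Heavyᴾ N (f ⊕ g)
  heavyᴾ-⊕ {f = f} {g} hf hg = heavyᴾ λ i →
    subst (Heavy _ i) (sym (coeff-⊕ f g i)) (heavy-+ (coeff-heavy hf i) (coeff-heavy hg i))

  heavyᴾ-neg : ∀ {N f} → Heavyᴾ N f → Heavyᴾ N (neg f)
  heavyᴾ-neg {f = f} hf = heavyᴾ λ i →
    subst (Heavy _ i) (sym (coeff-neg f i)) (heavy-neg (coeff-heavy hf i))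

  heavyᴾ-⊖ : ∀ {N f g} → Heavyᴾ N f → Heavyᴾ N g → Heavyᴾ N (f ⊖ g)
  heavyᴾ-⊖ hf hg = heavyᴾ-⊕ hf (heavyᴾ-neg hg)

  heavyᴾ-monomial : ∀ {a c} q → d ^ a ∣ ℤ.∣ c ∣ → Heavyᴾ (Q * a + B * q) (monomial c q)
  heavyᴾ-monomial {a} {c} q p = heavyᴾ at-degree
    where at-degree : ∀ i → Heavy (Q * a + B * q) i (coeff (monomial c q) i)
          at-degree i with i ℕ.≟ q
          ... | yes refl = subst (Heavy _ i) (sym (coeff-monomial-same c i)) (heavy a p ℕₚ.≤-refl)
          ... | no  i≢q  = subst (Heavy _ i) (sym (coeff-monomial-other c i≢q)) heavy-zero

  heavyᴾ-· : ∀ {N a c f} → d ^ a ∣ ℤ.∣ c ∣ → Heavyᴾ N f → Heavyᴾ (Q * a + N) (c · f)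
  heavyᴾ-· {a = a} {c} {f} p hf = heavyᴾ λ i →
    subst (Heavy _ i) (sym (coeff-· c f i))
          (heavy-* {a = c} (heavy a p (ℕₚ.m≤m+n (Q * a) (B * 0))) (coeff-heavy hf i))

  private
    HeavyFrom : ℕ → ℕ → Poly → Set
    HeavyFrom o N f = ∀ i → Heavy N (o + i) (coeff f i)

    heavy-at : ∀ {N i j a} → i ≡ j → Heavy N i a → Heavy N j a
    heavy-at {N} {a = a} = subst (λ i → Heavy N i a)

    heavyFrom-⊛ : ∀ {N M} o o′ f g → HeavyFrom o N f → HeavyFrom o′ M g →
                  HeavyFrom (o + o′) (N + M) (f ⊛ g)
    heavyFrom-⊛ o o′ []      g hf hg i = heavy-zero
    heavyFrom-⊛ o o′ (a ∷ f) g hf hg i = subst (Heavy _ _) (sym (coeff-⊕ (a · g) _ i))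
      (heavy-+ (subst (Heavy _ _) (sym (coeff-· a g i))
                      (heavy-at (trans (cong (_+ (o′ + i)) (ℕₚ.+-identityʳ o)) (sym (ℕₚ.+-assoc o o′ i)))
                                (heavy-* (hf 0) (hg i))))
               (tail i))
      where
      tail : ∀ i → Heavy _ (o + o′ + i) (coeff (+ 0 ∷ (f ⊛ g)) i)
      tail zero    = heavy-zero
      tail (suc i) = heavy-at (sym (ℕₚ.+-suc (o + o′) i))
        (heavyFrom-⊛ (suc o) o′ f g (λ j → heavy-at (ℕₚ.+-suc o j) (hf (suc j))) hg i)

  heavyᴾ-⊛ : ∀ {N M f g} → Heavyᴾ N f → Heavyᴾ M g → Heavyᴾ (N + M) (f ⊛ g)
  heavyᴾ-⊛ {f = f} {g} hf hg = heavyᴾ (heavyFrom-⊛ 0 0 f g (coeff-heavy hf) (coeff-heavy hg))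

  heavyᴾ-one : Heavyᴾ 0 one
  heavyᴾ-one = heavyᴾ-weaken z≤n (heavyᴾ-monomial {a = 0} 0 ℕ∣.∣-refl)

  heavyᴾ-^ : ∀ {N f} n → Heavyᴾ N f → Heavyᴾ (n * N) (f ^ᴾ n)
  heavyᴾ-^ zero    hf = heavyᴾ-one
  heavyᴾ-^ (suc n) hf = heavyᴾ-⊛ hf (heavyᴾ-^ n hf)

  heavyᴾ-pow-diff : ∀ {α β x y} n → Heavyᴾ α (x ⊖ y) → Heavyᴾ β x → Heavyᴾ β y →
                    Heavyᴾ (α + n * β) (x ^ᴾ suc n ⊖ y ^ᴾ suc n)
  heavyᴾ-pow-diff {α} {x = x} {y} zero hxy hx hy =
    heavyᴾ-weaken (ℕₚ.≤-reflexive (ℕₚ.+-identityʳ α))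
      (heavyᴾ-≈ (⊕-cong (≈-sym (⊛-identityʳ x)) (·-cong -1ℤ (≈-sym (⊛-identityʳ y)))) hxy)
  heavyᴾ-pow-diff {α} {β} {x} {y} (suc n) hxy hx hy =
    heavyᴾ-≈ (≈-sym (split x y (x ^ᴾ suc n) (y ^ᴾ suc n)))
      (heavyᴾ-⊕ (heavyᴾ-weaken (ℕₚ.≤-reflexive (ℕ+.x∙yz≈y∙xz α β (n * β)))
                               (heavyᴾ-⊛ hx (heavyᴾ-pow-diff n hxy hx hy)))
                (heavyᴾ-⊛ hxy (heavyᴾ-^ (suc n) hy)))
    where
    split : ∀ x y X Y → x ⊛ X ⊖ y ⊛ Y ≈ x ⊛ (X ⊖ Y) ⊕ (x ⊖ y) ⊛ Y
    split = solve 4 (λ x y X Y → x :* X :- y :* Y := x :* (X :- Y) :+ (x :- y) :* Y) ≈-refl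

  heavyᴾ-sum : ∀ {N n} (v : Fin n → Poly) → (∀ j → Heavyᴾ N (v j)) → Heavyᴾ N (sum v)
  heavyᴾ-sum {n = zero}  v hv = heavyᴾ-[]
  heavyᴾ-sum {n = suc n} v hv = heavyᴾ-⊕ (hv Fin.zero) (heavyᴾ-sum (λ j → v (Fin.suc j)) (λ j → hv (Fin.suc j)))

  heavyᴾ-X : Heavyᴾ B X
  heavyᴾ-X = heavyᴾ-weaken (ℕₚ.≤-reflexive (weight Q B)) (heavyᴾ-monomial {a = 0} 1 ℕ∣.∣-refl)
    where weight : ∀ Q B → B ≡ Q * 0 + B * 1
          weight = ℕ-solve

  heavyᴾ-b+1 : Heavyᴾ 0 b+1
  heavyᴾ-b+1 = heavyᴾ-⊕ heavyᴾ-one (heavyᴾ-weaken z≤n heavyᴾ-X)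

  heavyᴾ-d : Heavyᴾ Q (cst (+ d))
  heavyᴾ-d = heavyᴾ-weaken (ℕₚ.≤-reflexive (weight Q B))
                           (heavyᴾ-monomial {a = 1} 0 (ℕ∣.∣-reflexive (ℕₚ.*-identityʳ d)))
    where weight : ∀ Q B → Q ≡ Q * 1 + B * 0
          weight = ℕ-solve

  heavy⇒pow∣ : ∀ {a i x} → Heavy (suc (Q * a + B * i)) i x → d ^ suc a ∣ ℤ.∣ x ∣
  heavy⇒pow∣ {a} {i} (heavy e p w) =
    ℕ∣.∣-trans (^-monoʳ-∣ d (ℕₚ.*-cancelˡ-< Q a e (ℕₚ.+-cancelʳ-< (B * i) (Q * a) (Q * e) w))) p

  heavy-ord : ∀ {N i x n} → Heavy N i x → HasOrd d x (just n) → N ≤ Q * n + B * i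
  heavy-ord {x = x} (heavy e p w) (_ , d^n+1∤x) =
    ℕₚ.≤-trans w (ℕₚ.+-monoˡ-≤ _ (ℕₚ.*-monoʳ-≤ Q (pow∣⇒≤ord {x = x} p d^n+1∤x)))

middle-weight : ∀ {β γ} Q k r → β ≤ γ → Q + γ + (k + r) * β ≤ Q * 1 + (suc k * γ + r * β)
middle-weight {β} {γ} Q k r β≤γ = begin
  Q + γ + (k + r) * β            ≡⟨ regroup₁ Q γ β k r ⟩
  Q * 1 + (γ + r * β) + k * β    ≤⟨ ℕₚ.+-monoʳ-≤ (Q * 1 + (γ + r * β)) (ℕₚ.*-monoʳ-≤ k β≤γ) ⟩
  Q * 1 + (γ + r * β) + k * γ    ≡⟨ regroup₂ Q γ β k r ⟩
  Q * 1 + (suc k * γ + r * β)    ∎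
  where
  open ℕₚ.≤-Reasoning
  regroup₁ : ∀ Q γ β k r → Q + γ + (k + r) * β ≡ Q * 1 + (γ + r * β) + k * β
  regroup₁ = ℕ-solve
  regroup₂ : ∀ Q γ β k r → Q * 1 + (γ + r * β) + k * γ ≡ Q * 1 + (suc k * γ + r * β)
  regroup₂ = ℕ-solve

module _ {p Q B : ℕ} (1≤Q : 1 ≤ Q) (d-prime : Prime (suc p)) where
  open Weighted (suc p) Q B 1≤Q

  heavyᴾ-middleTerms : ∀ {β γ e s} → β ≤ γ → Heavyᴾ β s → Heavyᴾ γ e →
                       Heavyᴾ (Q + γ + p * β) (middleTerms p e s)
  heavyᴾ-middleTerms {β} {γ} {e} {s} β≤γ hs he =
    heavyᴾ-sum _ λ j → term (toℕ (inject₁ j)) (subst (_< p) (sym (Finₚ.toℕ-inject₁ j)) (Finₚ.toℕ<n j))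
    where
    term : ∀ k → k < p → Heavyᴾ (Q + γ + p * β) ((suc p C suc k) ×ˢ (e ^ˢ suc k ⊛ s ^ˢ (p ∸ k)))
    term k k<p = heavyᴾ-≈ (≈-sym (×ˢ≈· _ _)) (heavyᴾ-weaken weight
      (heavyᴾ-· {a = 1} d∣C (heavyᴾ-⊛ (heavyᴾ-≈ (≈-sym (^ˢ≈^ᴾ e (suc k))) (heavyᴾ-^ (suc k) he))
                                      (heavyᴾ-≈ (≈-sym (^ˢ≈^ᴾ s (p ∸ k))) (heavyᴾ-^ (p ∸ k) hs)))))
      where
      weight : Q + γ + p * β ≤ Q * 1 + (suc k * γ + (p ∸ k) * β)
      weight = subst (λ x → Q + γ + x * β ≤ Q * 1 + (suc k * γ + (p ∸ k) * β))
                     (ℕₚ.m+[n∸m]≡n (ℕₚ.<⇒≤ k<p)) (middle-weight Q k (p ∸ k) β≤γ)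
      d∣C : suc p ^ 1 ∣ suc p C suc k
      d∣C = subst (_∣ suc p C suc k) (sym (ℕₚ.*-identityʳ (suc p))) (prime∣C d-prime (s≤s z≤n) (s≤s k<p))

module _ (d : ℕ) where

  D-+ : ∀ a b → D d (a + b) ≡ D d a + d ^ a * D d b
  D-+ a zero    = begin
    D d (a + 0)           ≡⟨ cong (D d) (ℕₚ.+-identityʳ a) ⟩
    D d a                 ≡⟨ ℕₚ.+-identityʳ (D d a) ⟨
    D d a + 0             ≡⟨ cong (λ x → D d a + x) (ℕₚ.*-zeroʳ (d ^ a)) ⟨
    D d a + d ^ a * 0     ∎
    where open ≡-Reasoning
  D-+ a (suc b) = begin
    D d (a + suc b)                        ≡⟨ cong (D d) (ℕₚ.+-suc a b) ⟩
    d ^ (a + b) + D d (a + b)              ≡⟨ cong₂ _+_ (ℕₚ.^-distribˡ-+-* d a b) (D-+ a b) ⟩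
    d ^ a * d ^ b + (D d a + d ^ a * D d b) ≡⟨ regroup (d ^ a) (d ^ b) (D d a) (D d b) ⟩
    D d a + d ^ a * (d ^ b + D d b)        ∎
    where
    open ≡-Reasoning
    regroup : ∀ x y u v → x * y + (u + x * v) ≡ u + x * (y + v)
    regroup = ℕ-solve

  D>0 : 1 ≤ d → ∀ {t} → 0 < t → 0 < D d t
  D>0 1≤d {suc t} _ = ℕₚ.<-≤-trans (ℕₚ.m^n>0 d {{ℕ.>-nonZero 1≤d}} t) (ℕₚ.m≤m+n (d ^ t) (D d t))

module _ (p : ℕ) where

  ^≡pD+1 : ∀ n → suc p ^ n ≡ p * D (suc p) n + 1
  ^≡pD+1 zero    = cong (_+ 1) (sym (ℕₚ.*-zeroʳ p))
  ^≡pD+1 (suc n) = begin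
    suc p * suc p ^ n                          ≡⟨ cong (suc p *_) (^≡pD+1 n) ⟩
    suc p * (p * D (suc p) n + 1)              ≡⟨ regroup p (D (suc p) n) ⟩
    p * ((p * D (suc p) n + 1) + D (suc p) n) + 1 ≡⟨ cong (λ x → p * (x + D (suc p) n) + 1) (^≡pD+1 n) ⟨
    p * D (suc p) (suc n) + 1                  ∎
    where
    open ≡-Reasoning
    regroup : ∀ p x → suc p * (p * x + 1) ≡ p * ((p * x + 1) + x) + 1
    regroup = ℕ-solve

  D-suc : ∀ n → D (suc p) (suc n) ≡ suc p * D (suc p) n + 1
  D-suc n = begin
    suc p ^ n + D (suc p) n              ≡⟨ cong (_+ D (suc p) n) (^≡pD+1 n) ⟩
    p * D (suc p) n + 1 + D (suc p) n    ≡⟨ regroup p (D (suc p) n) ⟩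
    suc p * D (suc p) n + 1              ∎
    where
    open ≡-Reasoning
    regroup : ∀ p x → p * x + 1 + x ≡ suc p * x + 1
    regroup = ℕ-solve

-- The recurrence

∣^∣ : ∀ c n → ℤ.∣ c ℤ.^ n ∣ ≡ ℤ.∣ c ∣ ^ n
∣^∣ c zero    = refl
∣^∣ c (suc n) = trans (ℤₚ.abs-* c (c ℤ.^ n)) (cong (ℤ.∣ c ∣ *_) (∣^∣ c n))

+-^ : ∀ a n → (+ a) ℤ.^ n ≡ + (a ^ n)
+-^ a zero    = refl
+-^ a (suc n) = trans (cong (+ a ℤ.*_) (+-^ a n)) (sym (ℤₚ.pos-* a (a ^ n)))

module Recurrence (p : ℕ) where

  d : ℕ
  d = suc p

  e : ℕ → Poly
  e n = r d n ⊖ s d n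

  dᴾ : Poly
  dᴾ = cst (+ d)

  lead : ℕ → ℤ
  lead zero    = + d
  lead (suc j) = - (lead j ℤ.^ d)

  E : ℕ → Poly
  E j = monomial (lead j) (d ^ j)

  c : ℕ → Poly
  c n = cst (+ (d ^ D d n))

  ∣lead∣ : ∀ j → ℤ.∣ lead j ∣ ≡ d ^ (d ^ j)
  ∣lead∣ zero    = sym (ℕₚ.*-identityʳ d)
  ∣lead∣ (suc j) = begin
    ℤ.∣ - (lead j ℤ.^ d) ∣  ≡⟨ ℤₚ.∣-i∣≡∣i∣ (lead j ℤ.^ d) ⟩
    ℤ.∣ lead j ℤ.^ d ∣      ≡⟨ ∣^∣ (lead j) d ⟩
    ℤ.∣ lead j ∣ ^ d        ≡⟨ cong (_^ d) (∣lead∣ j) ⟩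
    (d ^ (d ^ j)) ^ d       ≡⟨ ℕₚ.^-*-assoc d (d ^ j) d ⟩
    d ^ (d ^ j * d)         ≡⟨ cong (d ^_) (ℕₚ.*-comm (d ^ j) d) ⟩
    d ^ (d ^ suc j)         ∎
    where open ≡-Reasoning

  E-suc : ∀ j → E (suc j) ≈ neg (E j ^ᴾ d)
  E-suc j = ≈-sym (begin
    neg (E j ^ᴾ d)                              ≈⟨ ·-cong -1ℤ (monomial-^ (lead j) (d ^ j) d) ⟩
    -1ℤ · monomial (lead j ℤ.^ d) (d * d ^ j)   ≈⟨ ·-monomial -1ℤ _ _ ⟩
    monomial (-1ℤ ℤ.* lead j ℤ.^ d) (d ^ suc j) ≈⟨ monomial-cong (ℤₚ.-1*i≡-i _) refl ⟩
    E (suc j)                                   ∎)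
    where open ≈-Reasoning

  d*[d^D]^d≡d^D-suc : ∀ n → d * (d ^ D d n) ^ d ≡ d ^ D d (suc n)
  d*[d^D]^d≡d^D-suc n = begin
    d * (d ^ D d n) ^ d     ≡⟨ cong (d *_) (ℕₚ.^-*-assoc d (D d n) d) ⟩
    d ^ suc (D d n * d)     ≡⟨ cong (λ x → d ^ suc x) (ℕₚ.*-comm (D d n) d) ⟩
    d ^ suc (d * D d n)     ≡⟨ cong (d ^_) (trans (ℕₚ.+-comm 1 _) (sym (D-suc p n))) ⟩
    d ^ D d (suc n)         ∎
    where open ≡-Reasoning

  c-suc : ∀ n → c (suc n) ≈ dᴾ ⊛ c n ^ᴾ d
  c-suc n = ≈-sym (begin
    dᴾ ⊛ c n ^ᴾ d                                     ≈⟨ ⊛-cong (≈-refl {dᴾ}) (monomial-^ (+ (d ^ D d n)) 0 d) ⟩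
    dᴾ ⊛ monomial ((+ (d ^ D d n)) ℤ.^ d) (d * 0)      ≈⟨ monomial-⊛ (+ d) _ 0 (d * 0) ⟩
    monomial (+ d ℤ.* (+ (d ^ D d n)) ℤ.^ d) (d * 0)   ≈⟨ monomial-cong coefficient (ℕₚ.*-zeroʳ d) ⟩
    c (suc n)                                         ∎)
    where
    open ≈-Reasoning
    coefficient : + d ℤ.* (+ (d ^ D d n)) ℤ.^ d ≡ + (d ^ D d (suc n))
    coefficient = trans (cong (λ x → + d ℤ.* x) (+-^ (d ^ D d n) d))
                        (trans (sym (ℤₚ.pos-* d _)) (cong +_ (d*[d^D]^d≡d^D-suc n)))

  r-suc : ∀ n → r d (suc n) ≈ b+1 ⊛ (dᴾ ⊛ (r d n ⊛ s d n ^ᴾ p))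
  r-suc n = ⊛-cong (≈-refl {b+1}) (≈-sym (cst⊛≈· (+ d) _))

  s-suc : ∀ n → s d (suc n) ≈ dᴾ ⊛ s d n ^ᴾ d ⊕ e n ^ᴾ d ⊕ middleTerms p (e n) (s d n)
  s-suc n = begin
    r d n ^ᴾ d ⊕ (+ p) · s d n ^ᴾ d
      ≈⟨ ⊕-cong (^ᴾ-cong d r≈e⊕s) ≈-refl ⟩
    (e n ⊕ s d n) ^ᴾ d ⊕ (+ p) · s d n ^ᴾ d
      ≈⟨ ⊕-cong (binomial-middleTerms p (e n) (s d n)) ≈-refl ⟩
    s d n ^ᴾ d ⊕ e n ^ᴾ d ⊕ M ⊕ (+ p) · s d n ^ᴾ d
      ≈⟨ regroup (s d n ^ᴾ d) (e n ^ᴾ d) M ((+ p) · s d n ^ᴾ d) ⟩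
    s d n ^ᴾ d ⊕ (+ p) · s d n ^ᴾ d ⊕ e n ^ᴾ d ⊕ M
      ≈⟨ ⊕-cong (⊕-cong (⊕-·-suc p (s d n ^ᴾ d)) ≈-refl) ≈-refl ⟩
    (+ d) · s d n ^ᴾ d ⊕ e n ^ᴾ d ⊕ M
      ≈⟨ ⊕-cong (⊕-cong (≈-sym (cst⊛≈· (+ d) (s d n ^ᴾ d))) ≈-refl) ≈-refl ⟩
    dᴾ ⊛ s d n ^ᴾ d ⊕ e n ^ᴾ d ⊕ M ∎
    where
    open ≈-Reasoning
    M = middleTerms p (e n) (s d n)
    r≈e⊕s : r d n ≈ e n ⊕ s d n
    r≈e⊕s = solve 2 (λ x y → x := (x :- y) :+ y) ≈-refl (r d n) (s d n)
    regroup : ∀ a b m x → a ⊕ b ⊕ m ⊕ x ≈ a ⊕ x ⊕ b ⊕ m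
    regroup = solve 4 (λ a b m x → a :+ b :+ m :+ x := a :+ x :+ b :+ m) ≈-refl

  e-E-suc : ∀ n j → e (suc n) ⊖ E (suc j) ≈
            dᴾ ⊛ (X ⊛ (r d n ⊛ s d n ^ᴾ p)) ⊕ dᴾ ⊛ (e n ⊛ s d n ^ᴾ p) ⊖ middleTerms p (e n) (s d n)
              ⊖ (e n ^ᴾ d ⊖ E j ^ᴾ d)
  e-E-suc n j = begin
    r d (suc n) ⊖ s d (suc n) ⊖ E (suc j)
      ≈⟨ ⊕-cong (⊕-cong (r-suc n) (·-cong -1ℤ (s-suc n))) (·-cong -1ℤ (E-suc j)) ⟩
    b+1 ⊛ (dᴾ ⊛ (r d n ⊛ S)) ⊖ (dᴾ ⊛ (s d n ⊛ S) ⊕ e n ^ᴾ d ⊕ M) ⊖ neg (E j ^ᴾ d)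
      ≈⟨ expand X dᴾ (r d n) (s d n) S (e n ^ᴾ d) M (E j ^ᴾ d) ⟩
    dᴾ ⊛ (X ⊛ (r d n ⊛ S)) ⊕ dᴾ ⊛ (e n ⊛ S) ⊖ M ⊖ (e n ^ᴾ d ⊖ E j ^ᴾ d) ∎
    where
    open ≈-Reasoning
    S = s d n ^ᴾ p
    M = middleTerms p (e n) (s d n)
    -- one ⊕ X reduces to b+1
    expand : ∀ X dᴾ r s S Ed M Ep →
             (one ⊕ X) ⊛ (dᴾ ⊛ (r ⊛ S)) ⊖ (dᴾ ⊛ (s ⊛ S) ⊕ Ed ⊕ M) ⊖ neg Ep ≈
             dᴾ ⊛ (X ⊛ (r ⊛ S)) ⊕ dᴾ ⊛ ((r ⊖ s) ⊛ S) ⊖ M ⊖ (Ed ⊖ Ep)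
    expand = solve 8 (λ X dᴾ r s S Ed M Ep →
      (con 1ℤ :+ X) :* (dᴾ :* (r :* S)) :- (dᴾ :* (s :* S) :+ Ed :+ M) :- (PolySolver.:- Ep) :=
      dᴾ :* (X :* (r :* S)) :+ dᴾ :* ((r :- s) :* S) :- M :- (Ed :- Ep)) ≈-refl

  s-c+E-suc : ∀ n j → s d (suc n) ⊖ c (suc n) ⊕ E (suc j) ≈
              dᴾ ⊛ (s d n ^ᴾ d ⊖ c n ^ᴾ d) ⊕ (e n ^ᴾ d ⊖ E j ^ᴾ d) ⊕ middleTerms p (e n) (s d n)
  s-c+E-suc n j = begin
    s d (suc n) ⊖ c (suc n) ⊕ E (suc j)
      ≈⟨ ⊕-cong (⊕-cong (s-suc n) (·-cong -1ℤ (c-suc n))) (E-suc j) ⟩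
    dᴾ ⊛ s d n ^ᴾ d ⊕ e n ^ᴾ d ⊕ M ⊖ dᴾ ⊛ c n ^ᴾ d ⊕ neg (E j ^ᴾ d)
      ≈⟨ regroup dᴾ (s d n ^ᴾ d) (c n ^ᴾ d) (e n ^ᴾ d) M (E j ^ᴾ d) ⟩
    dᴾ ⊛ (s d n ^ᴾ d ⊖ c n ^ᴾ d) ⊕ (e n ^ᴾ d ⊖ E j ^ᴾ d) ⊕ M ∎
    where
    open ≈-Reasoning
    M = middleTerms p (e n) (s d n)
    regroup : ∀ dᴾ S C Ed M Ep → dᴾ ⊛ S ⊕ Ed ⊕ M ⊖ dᴾ ⊛ C ⊕ neg Ep ≈ dᴾ ⊛ (S ⊖ C) ⊕ (Ed ⊖ Ep) ⊕ M
    regroup = solve 6 (λ dᴾ S C Ed M Ep →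
      dᴾ :* S :+ Ed :+ M :- dᴾ :* C :+ PolySolver.:- Ep := dᴾ :* (S :- C) :+ (Ed :- Ep) :+ M) ≈-refl

  d·one≈dᴾ : (+ d) · one ≈ dᴾ
  d·one≈dᴾ = ∷-cong (ℤₚ.*-identityʳ (+ d)) ≈-refl

  r₁≈ : r d 1 ≈ b+1 ⊛ dᴾ
  r₁≈ = ⊛-cong (≈-refl {b+1}) (≈-trans (·-cong (+ d) (⊛-cong (≈-refl {one}) (^ᴾ-one p))) d·one≈dᴾ)

  s₁≈ : s d 1 ≈ dᴾ
  s₁≈ = begin
    one ^ᴾ d ⊕ (+ p) · one ^ᴾ d  ≈⟨ ⊕-cong (^ᴾ-one d) (·-cong (+ p) (^ᴾ-one d)) ⟩
    one ⊕ (+ p) · one            ≈⟨ ⊕-·-suc p one ⟩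
    (+ d) · one                  ≈⟨ d·one≈dᴾ ⟩
    dᴾ                           ∎
    where open ≈-Reasoning

  e₁≈E₀ : e 1 ≈ E 0
  e₁≈E₀ = begin
    r d 1 ⊖ s d 1           ≈⟨ ⊕-cong r₁≈ (·-cong -1ℤ s₁≈) ⟩
    (one ⊕ X) ⊛ dᴾ ⊖ dᴾ     ≈⟨ solve 2 (λ X dᴾ → (con 1ℤ :+ X) :* dᴾ :- dᴾ := X :* dᴾ) ≈-refl X dᴾ ⟩
    X ⊛ dᴾ                  ≈⟨ monomial-⊛ 1ℤ (+ d) 1 0 ⟩
    monomial (1ℤ ℤ.* + d) 1 ≈⟨ monomial-cong {q = 1} (ℤₚ.*-identityˡ (+ d)) refl ⟩
    E 0 ∎
    where open ≈-Reasoning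

  s₁-c₁≈[] : s d 1 ⊖ c 1 ≈ []
  s₁-c₁≈[] = ≈-trans (⊕-cong s₁≈ (·-cong -1ℤ (∷-cong (cong +_ (ℕₚ.*-identityʳ d)) ≈-refl))) (⊕-inverseʳ dᴾ)

  module Content where
    open Weighted d 1 0 (s≤s z≤n)

    content : ∀ j → Heavyᴾ (d ^ j) (r d (suc j)) × Heavyᴾ (d ^ j) (s d (suc j))
    content zero    = heavyᴾ-≈ (≈-sym r₁≈) (heavyᴾ-⊛ heavyᴾ-b+1 heavyᴾ-d) , heavyᴾ-≈ (≈-sym s₁≈) heavyᴾ-d
    content (suc j) with content j
    ... | hr , hs =
      heavyᴾ-≈ (≈-sym (r-suc (suc j)))
        (heavyᴾ-weaken (ℕₚ.n≤1+n _) (heavyᴾ-⊛ heavyᴾ-b+1 (heavyᴾ-⊛ heavyᴾ-d (heavyᴾ-⊛ hr (heavyᴾ-^ p hs))))) ,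
      heavyᴾ-⊕ (heavyᴾ-^ d hr) (heavyᴾ-· {a = 0} (ℕ∣.1∣ _) (heavyᴾ-^ d hs))

    ord-s≥ : ∀ j i v → HasOrd d (coeff (s d (suc j)) i) v → v ≥∞ (d ^ j)
    ord-s≥ j i nothing  _   = tt
    ord-s≥ j i (just n) ord = ℕₚ.≤-trans (heavy-ord (coeff-heavy (proj₂ (content j)) i) ord)
                                         (ℕₚ.≤-reflexive (weight n i))
      where weight : ∀ n i → 1 * n + 0 * i ≡ n
            weight = ℕ-solve

  module NewtonPolygon (k : ℕ) (d-prime : Prime d) (0<k : 0 < k) where

    Q B : ℕ
    Q = d ^ k
    B = D d k

    β γ : ℕ → ℕ
    β n = Q * D d n
    γ j = d ^ j * (Q + B)

    d^>0 : ∀ j → 0 < d ^ j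
    d^>0 = ℕₚ.m^n>0 d

    β-suc : ∀ n → β (suc n) ≡ Q + d * β n
    β-suc n = trans (cong (Q *_) (D-suc p n)) (regroup Q d (D d n))
      where regroup : ∀ Q d x → Q * (d * x + 1) ≡ Q + d * (Q * x)
            regroup = ℕ-solve

    β-suc′ : ∀ n → β (suc n) ≡ Q + β n + p * β n
    β-suc′ n = trans (β-suc n) (sym (ℕₚ.+-assoc Q (β n) (p * β n)))

    γ-suc : ∀ j → γ (suc j) ≡ d * γ j
    γ-suc j = ℕₚ.*-assoc d (d ^ j) (Q + B)

    Q-split : ∀ {j t} → j + t ≡ k → Q ≡ d ^ j * d ^ t
    Q-split {j} {t} j+t≡k = trans (cong (d ^_) (sym j+t≡k)) (ℕₚ.^-distribˡ-+-* d j t)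

    γ-split : ∀ {j t} → j + t ≡ k → γ j ≡ β (suc j) + d ^ j * D d t
    γ-split {j} {t} j+t≡k = begin
      d ^ j * (Q + B)
        ≡⟨ cong₂ (λ q b → d ^ j * (q + b)) (Q-split {j} {t} j+t≡k) B≡ ⟩
      d ^ j * (d ^ j * d ^ t + (D d t + d ^ t * D d j))
        ≡⟨ regroup (d ^ j) (d ^ t) (D d j) (D d t) ⟩
      d ^ j * d ^ t * (d ^ j + D d j) + d ^ j * D d t
        ≡⟨ cong (λ q → q * D d (suc j) + d ^ j * D d t) (Q-split {j} {t} j+t≡k) ⟨
      β (suc j) + d ^ j * D d t ∎
      where
      open ≡-Reasoning
      B≡ : B ≡ D d t + d ^ t * D d j
      B≡ = trans (cong (D d) (trans (sym j+t≡k) (ℕₚ.+-comm j t))) (D-+ d t j)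
      regroup : ∀ x y u v → x * (x * y + (v + y * u)) ≡ x * y * (x + u) + x * v
      regroup = ℕ-solve

    β≤γ : ∀ {j} → j ≤ k → β (suc j) ≤ γ j
    β≤γ {j} j≤k = ℕₚ.≤-trans (ℕₚ.m≤m+n (β (suc j)) _) (ℕₚ.≤-reflexive (sym (γ-split {j} (ℕₚ.m+[n∸m]≡n j≤k))))

    β<γ : ∀ {j} → j < k → β (suc j) < γ j
    β<γ {j} j<k = ℕₚ.<-≤-trans
      (ℕₚ.m<m+n (β (suc j)) (ℕₚ.*-mono-≤ (d^>0 j) (D>0 d (s≤s z≤n) (ℕₚ.m<n⇒0<n∸m j<k))))
      (ℕₚ.≤-reflexive (sym (γ-split {j} (ℕₚ.m+[n∸m]≡n (ℕₚ.<⇒≤ j<k)))))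

    dγ+d^j≡Q+γ+pβ : ∀ {j t} → j + t ≡ k → d * γ j + d ^ j ≡ Q + γ j + p * β (suc j)
    dγ+d^j≡Q+γ+pβ {j} {t} j+t≡k = begin
      γ j + p * γ j + d ^ j
        ≡⟨ cong (λ g → γ j + p * g + d ^ j) (γ-split {j} {t} j+t≡k) ⟩
      γ j + p * (β (suc j) + d ^ j * D d t) + d ^ j
        ≡⟨ regroup (γ j) p (β (suc j)) (d ^ j) (D d t) ⟩
      d ^ j * (p * D d t + 1) + γ j + p * β (suc j)
        ≡⟨ cong (λ y → d ^ j * y + γ j + p * β (suc j)) (^≡pD+1 p t) ⟨
      d ^ j * d ^ t + γ j + p * β (suc j)
        ≡⟨ cong (λ q → q + γ j + p * β (suc j)) (Q-split {j} {t} j+t≡k) ⟨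
      Q + γ j + p * β (suc j) ∎
      where
      open ≡-Reasoning
      regroup : ∀ g p b x v → g + p * (b + x * v) + x ≡ x * (p * v + 1) + g + p * b
      regroup = ℕ-solve

    dγ+D≡Q+B+dβ : ∀ {j t} → j + t ≡ k → d * γ j + D d (suc j) ≡ Q + (B + d * β (suc j))
    dγ+D≡Q+B+dβ {j} {t} j+t≡k = begin
      d * γ j + D d (suc j)
        ≡⟨ cong (λ g → d * g + D d (suc j)) (γ-split {j} {t} j+t≡k) ⟩
      d * (β (suc j) + d ^ j * D d t) + D d (suc j)
        ≡⟨ regroup d (β (suc j)) (d ^ j) (D d t) (D d (suc j)) ⟩
      D d (suc j) + d ^ suc j * D d t + d * β (suc j)
        ≡⟨ cong (_+ d * β (suc j)) D-suc-k ⟨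
      D d (suc k) + d * β (suc j)
        ≡⟨ ℕₚ.+-assoc Q B (d * β (suc j)) ⟩
      Q + (B + d * β (suc j)) ∎
      where
      open ≡-Reasoning
      D-suc-k : D d (suc k) ≡ D d (suc j) + d ^ suc j * D d t
      D-suc-k = trans (cong (λ x → D d (suc x)) (sym j+t≡k)) (D-+ d (suc j) t)
      regroup : ∀ d b x v u → d * (b + x * v) + u ≡ u + d * x * v + d * b
      regroup = ℕ-solve

    dγ<Q+γ+pβ : ∀ {j} → j ≤ k → d * γ j < Q + γ j + p * β (suc j)
    dγ<Q+γ+pβ {j} j≤k =
      subst (d * γ j <_) (dγ+d^j≡Q+γ+pβ {j} (ℕₚ.m+[n∸m]≡n j≤k)) (ℕₚ.m<m+n (d * γ j) (d^>0 j))

    dγ<Q+B+dβ : ∀ {j} → j ≤ k → d * γ j < Q + (B + d * β (suc j))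
    dγ<Q+B+dβ {j} j≤k =
      subst (d * γ j <_) (dγ+D≡Q+B+dβ {j} (ℕₚ.m+[n∸m]≡n j≤k))
            (ℕₚ.m<m+n (d * γ j) (D>0 d (s≤s z≤n) {suc j} (s≤s z≤n)))

    β≤dγ : ∀ {j} → suc j ≤ k → β (suc (suc j)) ≤ d * γ j
    β≤dγ {j} 1+j≤k = subst (β (suc (suc j)) ≤_) (γ-suc j) (β≤γ 1+j≤k)

    β≤Q+γ+pβ : ∀ {j} → j ≤ k → β (suc (suc j)) ≤ Q + γ j + p * β (suc j)
    β≤Q+γ+pβ {j} j≤k = ℕₚ.≤-trans (ℕₚ.≤-reflexive (β-suc′ (suc j)))
                                  (ℕₚ.+-monoˡ-≤ (p * β (suc j)) (ℕₚ.+-monoʳ-≤ Q (β≤γ j≤k)))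

    β<Q+γ+pβ : ∀ {j} → j < k → β (suc (suc j)) < Q + γ j + p * β (suc j)
    β<Q+γ+pβ {j} j<k = ℕₚ.≤-trans (ℕₚ.≤-reflexive (cong suc (β-suc′ (suc j))))
                                  (ℕₚ.+-monoˡ-≤ (p * β (suc j)) (ℕₚ.+-monoʳ-< Q (β<γ j<k)))

    open Weighted d Q B (d^>0 k)

    heavyᴾ-E : ∀ j → Heavyᴾ (γ j) (E j)
    heavyᴾ-E j = heavyᴾ-weaken (ℕₚ.≤-reflexive (regroup (d ^ j) Q B))
                               (heavyᴾ-monomial (d ^ j) (ℕ∣.∣-reflexive (sym (∣lead∣ j))))
      where regroup : ∀ x Q B → x * (Q + B) ≡ Q * x + B * x
            regroup = ℕ-solve

    heavyᴾ-c : ∀ n → Heavyᴾ (β n) (c n)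
    heavyᴾ-c n = heavyᴾ-weaken (ℕₚ.m≤m+n (β n) (B * 0)) (heavyᴾ-monomial {a = D d n} 0 ℕ∣.∣-refl)

    heavyᴾ-r-suc : ∀ {n} → Heavyᴾ (β n) (r d n) → Heavyᴾ (β n) (s d n) → Heavyᴾ (β (suc n)) (r d (suc n))
    heavyᴾ-r-suc {n} hr hs = heavyᴾ-≈ (≈-sym (r-suc n)) (heavyᴾ-weaken (ℕₚ.≤-reflexive (β-suc n))
      (heavyᴾ-⊛ heavyᴾ-b+1 (heavyᴾ-⊛ heavyᴾ-d (heavyᴾ-⊛ hr (heavyᴾ-^ p hs)))))

    record Invariant (j : ℕ) : Set where
      field
        r-heavy     : Heavyᴾ (β (suc j)) (r d (suc j))
        s-heavy     : Heavyᴾ (β (suc j)) (s d (suc j))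
        e-E-heavy   : Heavyᴾ (suc (γ j)) (e (suc j) ⊖ E j)
        s-c+E-heavy : Heavyᴾ (suc (β (suc j))) (s d (suc j) ⊖ c (suc j) ⊕ E j)

    invariant-base : Invariant 0
    invariant-base = record
      { r-heavy     = heavyᴾ-r-suc {0} one-heavy one-heavy
      ; s-heavy     = heavyᴾ-≈ (≈-sym s₁≈) (heavyᴾ-weaken (ℕₚ.≤-reflexive (ℕₚ.*-identityʳ Q)) heavyᴾ-d)
      ; e-E-heavy   = heavyᴾ-≈ (≈-sym (≈-trans (⊕-cong e₁≈E₀ ≈-refl) (⊕-inverseʳ (E 0)))) heavyᴾ-[]
      ; s-c+E-heavy = heavyᴾ-≈ (≈-sym (⊕-cong s₁-c₁≈[] ≈-refl)) (heavyᴾ-weaken (β<γ 0<k) (heavyᴾ-E 0))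
      }
      where one-heavy : Heavyᴾ (β 0) one
            one-heavy = heavyᴾ-weaken (ℕₚ.≤-reflexive (ℕₚ.*-zeroʳ Q)) heavyᴾ-one

    module Step {j} (j<k : j < k) (inv : Invariant j) where
      open Invariant inv
      n = suc j
      j≤k = ℕₚ.<⇒≤ j<k

      e-heavy : Heavyᴾ (γ j) (e n)
      e-heavy = heavyᴾ-≈ (≈-sym (solve 2 (λ x y → x := x :- y :+ y) ≈-refl (e n) (E j)))
                         (heavyᴾ-⊕ (heavyᴾ-weaken (ℕₚ.n≤1+n (γ j)) e-E-heavy) (heavyᴾ-E j))

      s-c-heavy : Heavyᴾ (suc (β n)) (s d n ⊖ c n)
      s-c-heavy = heavyᴾ-≈ (≈-sym (solve 3 (λ x y z → x :- y := x :- y :+ z :- z) ≈-refl (s d n) (c n) (E j)))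
                           (heavyᴾ-⊖ s-c+E-heavy (heavyᴾ-weaken (β<γ j<k) (heavyᴾ-E j)))

      e^d-E^d-heavy : Heavyᴾ (suc (d * γ j)) (e n ^ᴾ d ⊖ E j ^ᴾ d)
      e^d-E^d-heavy = heavyᴾ-pow-diff p e-E-heavy e-heavy (heavyᴾ-E j)

      M-heavy : Heavyᴾ (Q + γ j + p * β n) (middleTerms p (e n) (s d n))
      M-heavy = heavyᴾ-middleTerms (d^>0 k) d-prime (β≤γ j≤k) s-heavy e-heavy

      s-heavy-suc : Heavyᴾ (β (suc n)) (s d (suc n))
      s-heavy-suc = heavyᴾ-≈ (≈-sym (s-suc n)) (heavyᴾ-⊕ (heavyᴾ-⊕
        (heavyᴾ-weaken (ℕₚ.≤-reflexive (β-suc n)) (heavyᴾ-⊛ heavyᴾ-d (heavyᴾ-^ d s-heavy)))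
        (heavyᴾ-weaken (β≤dγ j<k) (heavyᴾ-^ d e-heavy)))
        (heavyᴾ-weaken (β≤Q+γ+pβ j≤k) M-heavy))

      e-E-heavy-suc : Heavyᴾ (suc (γ (suc j))) (e (suc n) ⊖ E (suc j))
      e-E-heavy-suc = heavyᴾ-≈ (≈-sym (e-E-suc n j))
        (heavyᴾ-weaken (ℕₚ.≤-reflexive (cong suc (γ-suc j)))
          (heavyᴾ-⊖ (heavyᴾ-⊖ (heavyᴾ-⊕
            (heavyᴾ-weaken (dγ<Q+B+dβ j≤k)
              (heavyᴾ-⊛ heavyᴾ-d (heavyᴾ-⊛ heavyᴾ-X (heavyᴾ-⊛ r-heavy (heavyᴾ-^ p s-heavy)))))
            (heavyᴾ-weaken (ℕₚ.≤-trans (dγ<Q+γ+pβ j≤k) (ℕₚ.≤-reflexive (ℕₚ.+-assoc Q (γ j) _)))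
              (heavyᴾ-⊛ heavyᴾ-d (heavyᴾ-⊛ e-heavy (heavyᴾ-^ p s-heavy)))))
            (heavyᴾ-weaken (dγ<Q+γ+pβ j≤k) M-heavy))
            e^d-E^d-heavy))

      s-c+E-heavy-suc : Heavyᴾ (suc (β (suc n))) (s d (suc n) ⊖ c (suc n) ⊕ E (suc j))
      s-c+E-heavy-suc = heavyᴾ-≈ (≈-sym (s-c+E-suc n j)) (heavyᴾ-⊕ (heavyᴾ-⊕
        (heavyᴾ-weaken (ℕₚ.≤-reflexive (trans (cong suc (β-suc n)) (sym (ℕₚ.+-suc Q _))))
          (heavyᴾ-⊛ heavyᴾ-d (heavyᴾ-pow-diff p s-c-heavy s-heavy (heavyᴾ-c n))))
        (heavyᴾ-weaken (s≤s (β≤dγ j<k)) e^d-E^d-heavy))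
        (heavyᴾ-weaken (β<Q+γ+pβ j<k) M-heavy))

    invariant-suc : ∀ {j} → j < k → Invariant j → Invariant (suc j)
    invariant-suc {j} j<k inv = record
      { r-heavy     = heavyᴾ-r-suc {suc j} r-heavy s-heavy
      ; s-heavy     = s-heavy-suc
      ; e-E-heavy   = e-E-heavy-suc
      ; s-c+E-heavy = s-c+E-heavy-suc
      }
      where open Invariant inv
            open Step j<k inv

    invariant : ∀ {j} → j ≤ k → Invariant j
    invariant {zero}  _     = invariant-base
    invariant {suc j} 1+j≤k = invariant-suc 1+j≤k (invariant (ℕₚ.≤-trans (ℕₚ.n≤1+n j) 1+j≤k))

    s-heavy-top : Heavyᴾ (β (suc k)) (s d (suc k))
    s-heavy-top = Invariant.s-heavy (invariant ℕₚ.≤-refl)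

    ρ : Poly
    ρ = s d (suc k) ⊖ c (suc k) ⊕ E k

    ρ-heavy : Heavyᴾ (suc (β (suc k))) ρ
    ρ-heavy = Invariant.s-c+E-heavy (invariant ℕₚ.≤-refl)

    coeff-s : ∀ i → coeff (s d (suc k)) i ≡ (coeff (c (suc k)) i ℤ.- coeff (E k) i) ℤ.+ coeff ρ i
    coeff-s i = begin
      coeff (s d (suc k)) i
        ≡⟨ at split i ⟩
      coeff (c (suc k) ⊖ E k ⊕ ρ) i
        ≡⟨ coeff-⊕ (c (suc k) ⊖ E k) ρ i ⟩
      coeff (c (suc k) ⊖ E k) i ℤ.+ coeff ρ i
        ≡⟨ cong (ℤ._+ coeff ρ i) (coeff-⊕ (c (suc k)) (neg (E k)) i) ⟩
      coeff (c (suc k)) i ℤ.+ coeff (neg (E k)) i ℤ.+ coeff ρ i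
        ≡⟨ cong (λ x → coeff (c (suc k)) i ℤ.+ x ℤ.+ coeff ρ i) (coeff-neg (E k) i) ⟩
      (coeff (c (suc k)) i ℤ.- coeff (E k) i) ℤ.+ coeff ρ i ∎
      where
      open ≡-Reasoning
      split : s d (suc k) ≈ c (suc k) ⊖ E k ⊕ ρ
      split = solve 3 (λ x y z → x := y :- z :+ (x :- y :+ z)) ≈-refl (s d (suc k)) (c (suc k)) (E k)

    hasOrd-s : ∀ i a → ℤ.∣ coeff (c (suc k)) i ℤ.- coeff (E k) i ∣ ≡ d ^ a → Q * a + B * i ≡ β (suc k) →
               HasOrd d (coeff (s d (suc k)) i) (just a)
    hasOrd-s i a ∣c-E∣≡d^a weight≡β = subst (λ x → HasOrd d x (just a)) (sym (coeff-s i))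
      (hasOrd-+ a (coeff (c (suc k)) i ℤ.- coeff (E k) i) (prime⇒>1 d-prime) ∣c-E∣≡d^a
                (heavy⇒pow∣ (heavy-weaken (s≤s (ℕₚ.≤-reflexive weight≡β)) (coeff-heavy ρ-heavy i))))

    ord-s₀ : HasOrd d (coeff (s d (suc k)) 0) (just (D d (suc k)))
    ord-s₀ = hasOrd-s 0 (D d (suc k)) ∣c-E∣ weight
      where
      ∣c-E∣ : ℤ.∣ + (d ^ D d (suc k)) ℤ.- coeff (E k) 0 ∣ ≡ d ^ D d (suc k)
      ∣c-E∣ = trans (cong (λ x → ℤ.∣ + (d ^ D d (suc k)) ℤ.- x ∣) E₀≡0) (ℕₚ.+-identityʳ _)
        where E₀≡0 = coeff-monomial-other (lead k) (ℕₚ.<⇒≢ (d^>0 k))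
      weight : β (suc k) + B * 0 ≡ β (suc k)
      weight = trans (cong (λ x → β (suc k) + x) (ℕₚ.*-zeroʳ B)) (ℕₚ.+-identityʳ _)

    ord-s-vertex : HasOrd d (coeff (s d (suc k)) Q) (just Q)
    ord-s-vertex = hasOrd-s Q Q ∣c-E∣ (weight Q B)
      where
      ∣c-E∣ : ℤ.∣ coeff (c (suc k)) Q ℤ.- coeff (E k) Q ∣ ≡ d ^ Q
      ∣c-E∣ = begin
        ℤ.∣ coeff (c (suc k)) Q ℤ.- coeff (E k) Q ∣
          ≡⟨ cong₂ (λ x y → ℤ.∣ x ℤ.- y ∣) (coeff-monomial-other _ (ℕₚ.n>0⇒n≢0 (d^>0 k)))
                                           (coeff-monomial-same (lead k) Q) ⟩
        ℤ.∣ + 0 ℤ.- lead k ∣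
          ≡⟨ cong ℤ.∣_∣ (ℤₚ.+-identityˡ (- lead k)) ⟩
        ℤ.∣ - lead k ∣
          ≡⟨ ℤₚ.∣-i∣≡∣i∣ (lead k) ⟩
        ℤ.∣ lead k ∣
          ≡⟨ ∣lead∣ k ⟩
        d ^ Q ∎
        where open ≡-Reasoning
      weight : ∀ Q B → Q * Q + B * Q ≡ Q * (Q + B)
      weight = ℕ-solve

    ord-s-above-line : ∀ i v → HasOrd d (coeff (s d (suc k)) i) v → AboveLine (D d (suc k)) B Q i v
    ord-s-above-line i nothing  _   = tt
    ord-s-above-line i (just n) ord =
      subst (_≤ Q * n + B * i) (ℕₚ.*-comm Q (D d (suc k))) (heavy-ord (coeff-heavy s-heavy-top i) ord)

proposition4p2 : (d : ℕ) → Prime d → 3 ≤ d → (m : ℕ) → 2 ≤ m →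
    HasOrd d (coeff (s d m) 0) (just (D d m))
    × ((i : ℕ) → 0 < i → i < d ^ (m ∸ 1) → (v : ℕ∞) → HasOrd d (coeff (s d m) i) v →
        AboveLine (D d m) (D d (m ∸ 1)) (d ^ (m ∸ 1)) i v)
    × HasOrd d (coeff (s d m) (d ^ (m ∸ 1))) (just (d ^ (m ∸ 1)))
    × ((i : ℕ) → d ^ (m ∸ 1) < i → (v : ℕ∞) → HasOrd d (coeff (s d m) i) v →
        v ≥∞ (d ^ (m ∸ 1)))
proposition4p2 zero    _       ()  _             _
proposition4p2 (suc p) _       _   zero          ()
proposition4p2 (suc p) _       _   (suc zero)    (s≤s ())
proposition4p2 (suc p) d-prime _   (suc (suc k)) _ =
  ord-s₀ , (λ i _ _ → ord-s-above-line i) , ord-s-vertex , (λ i _ → ord-s≥ (suc k) i)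
  where
  open Recurrence p
  open Content using (ord-s≥)
  open NewtonPolygon (suc k) d-prime (s≤s z≤n)
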